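{- Let $q(x)$ be a multilinear polynomial of degree at most $d$ in $n$ variables with $\mathrm{sparsity}(q)=T$. For $\mathbf x$ uniformly distributed on $\{0,1\}^n$, the random variable $q(\mathbf x)$ takes at least $\frac{1}{2d^2}\log(T)-2$ distinct output values.
   Context: $\mathrm{sparsity}(q)$ is the number of nonzero coefficients of $q$ in its monomial expansion. Here $\log$ denotes the base-2 logarithm.
   Formalization: The coefficients of the multilinear polynomial q are rational. -}

module Defs where

open import Data.Bool using (Bool; true; false; if_then_else_)
open import Data.Nat using (ℕ; zero; suc; _≤_)
open import Data.List using (List; []; _∷_; map; _++_; length; filter; foldr; deduplicate)
open import Data.Vec using (Vec; []; _∷_)
open import Data.Rational using (ℚ; 0ℚ; 1ℚ; _+_; _*_; _≟_)
open import Relation.Nullary using (¬?)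

allBoolVecs : (n : ℕ) → List (Vec Bool n)
allBoolVecs zero = [] ∷ []
allBoolVecs (suc n) = map (false ∷_) (allBoolVecs n) ++ map (true ∷_) (allBoolVecs n)

-- A multilinear polynomial in n variables with rational coefficients:
-- q(x) = Σ_{S ⊆ [n]} c_S ∏_{i ∈ S} x_i ; a monomial set S is a Boolean vector.
MultilinearPoly : ℕ → Set
MultilinearPoly n = Vec Bool n → ℚ

boolToℚ : Bool → ℚ
boolToℚ true = 1ℚ
boolToℚ false = 0ℚ

monomial : ∀ {n} → Vec Bool n → Vec Bool n → ℚ
monomial [] [] = 1ℚ
monomial (s ∷ S) (b ∷ x) = (if s then boolToℚ b else 1ℚ) * monomial S x

sumℚ : List ℚ → ℚ
sumℚ = foldr _+_ 0ℚ

eval : ∀ {n} → MultilinearPoly n → Vec Bool n → ℚ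
eval {n} q x = sumℚ (map (λ S → q S * monomial S x) (allBoolVecs n))

card : ∀ {n} → Vec Bool n → ℕ
card [] = 0
card (true ∷ S) = suc (card S)
card (false ∷ S) = card S

DegreeAtMost : ∀ {n} → ℕ → MultilinearPoly n → Set
DegreeAtMost d q = ∀ S → ¬ (q S ≡ 0ℚ) → card S ≤ d
  where open import Relation.Binary.PropositionalEquality using (_≡_)
        open import Relation.Nullary using (¬_)

sparsity : ∀ {n} → MultilinearPoly n → ℕ
sparsity {n} q = length (filter (λ S → ¬? (q S ≟ 0ℚ)) (allBoolVecs n))

numDistinctValues : ∀ {n} → MultilinearPoly n → ℕ
numDistinctValues {n} q = length (deduplicate _≟_ (map (eval q) (allBoolVecs n)))

-- Write F for the function x ↦ eval q x on the cube {0,1}ⁿ and k for the number of its values.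
-- A multilinear polynomial of degree ≤ d whose function depends on only r of the variables has
-- at most (r + 1)ᵈ monomials, so it suffices to bound r. Composing F with the Lagrange
-- interpolation polynomial of each of its k values gives 0/1-valued functions of degree ≤ k d;
-- a Poincaré-type inequality bounds the total influence of each of them by 4 (k d + 1) 2ⁿ, and
-- since together they detect every change of F, the total influence of F is at most
-- 4 k (k d + 1) 2ⁿ. By Schwartz–Zippel, on the other hand, every variable that F depends on has
-- influence at least 2ⁿ⁺¹⁻ᵈ, so r ≤ 2ᵈ⁺¹ k (k d + 1), which gives the bound.

module Submission where

open import Defs

open import Algebra.Bundles using (CommutativeRing)
open import Data.Bool using (Bool; true; false)
open import Data.Fin using (Fin; zero; suc)
open import Data.List using (List; []; _∷_; map; _++_)
open import Data.List.Membership.Propositional using (_∈_)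
open import Data.List.Membership.Propositional.Properties using (∈-map⁺; ∈-++⁺ˡ; ∈-++⁺ʳ)
open import Data.List.Properties using (map-++; map-∘)
open import Data.List.Relation.Unary.Any using (here)
open import Data.Nat using (ℕ; zero; suc)
open import Data.Product using (_,_)
open import Data.Sum using (inj₁; inj₂)
open import Data.Vec using (Vec; []; _∷_; tail; _[_]≔_)
open import Function using (_∘_)
open import Relation.Binary.PropositionalEquality

private variable
  n : ℕ

face₀ face₁ : {A : Set} → (Vec Bool (suc n) → A) → Vec Bool n → A
face₀ f x = f (false ∷ x)
face₁ f x = f (true ∷ x)

map-allBoolVecs : {A : Set} (f : Vec Bool (suc n) → A) →
  map f (allBoolVecs (suc n)) ≡ map (face₀ f) (allBoolVecs n) ++ map (face₁ f) (allBoolVecs n)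
map-allBoolVecs {n} f =
  trans (map-++ f (map (false ∷_) cube) _) (cong₂ _++_ (sym (map-∘ cube)) (sym (map-∘ cube)))
  where
  cube : List (Vec Bool n)
  cube = allBoolVecs n

∈-allBoolVecs : (x : Vec Bool n) → x ∈ allBoolVecs n
∈-allBoolVecs [] = here refl
∈-allBoolVecs {suc n} (false ∷ x) = ∈-++⁺ˡ (∈-map⁺ (false ∷_) (∈-allBoolVecs x))
∈-allBoolVecs {suc n} (true ∷ x) =
  ∈-++⁺ʳ (map (false ∷_) (allBoolVecs n)) (∈-map⁺ (true ∷_) (∈-allBoolVecs x))

module Rationals where

  import Data.Nat as ℕ
  open import Data.Rational using (ℚ; 0ℚ; 1ℚ; _+_; _*_; -_; _≤_)
  import Data.Rational as ℚ using (nonNegative; nonPositive)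
  import Data.Rational.Properties as ℚ
  open import Data.Rational.Solver using (module +-*-Solver)
  open import Relation.Nullary using (contradiction)
  import Algebra.Properties.Semiring.Mult (CommutativeRing.semiring ℚ.+-*-commutativeRing) as Mult
  open +-*-Solver

  fromℕ : ℕ → ℚ
  fromℕ m = m Mult.× 1ℚ

  fromℕ-+ : ∀ a b → fromℕ (a ℕ.+ b) ≡ fromℕ a + fromℕ b
  fromℕ-+ = Mult.×-homo-+ 1ℚ

  fromℕ-* : ∀ a b → fromℕ (a ℕ.* b) ≡ fromℕ a * fromℕ b
  fromℕ-* = Mult.×1-homo-*

  fromℕ-nonneg : ∀ m → 0ℚ ≤ fromℕ m
  fromℕ-nonneg zero = ℚ.≤-refl
  fromℕ-nonneg (suc m) = ℚ.+-mono-≤ (ℚ.nonNegative⁻¹ 1ℚ) (fromℕ-nonneg m)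

  +-cancelˡ-≤ : ∀ r {p q} → r + p ≤ r + q → p ≤ q
  +-cancelˡ-≤ r {p} {q} r+p≤r+q = begin
    p             ≡⟨ solve 2 (λ r p → p := (:- r) :+ (r :+ p)) refl r p ⟩
    - r + (r + p) ≤⟨ ℚ.+-monoʳ-≤ (- r) r+p≤r+q ⟩
    - r + (r + q) ≡⟨ solve 2 (λ r q → (:- r) :+ (r :+ q) := q) refl r q ⟩
    q             ∎
    where open ℚ.≤-Reasoning

  fromℕ-cancel-≤ : ∀ a b → fromℕ a ≤ fromℕ b → a ℕ.≤ b
  fromℕ-cancel-≤ zero b _ = ℕ.z≤n
  fromℕ-cancel-≤ (suc a) zero 1+a≤0 = contradiction (begin-strict
    0ℚ            <⟨ ℚ.positive⁻¹ 1ℚ ⟩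
    1ℚ            ≡⟨ ℚ.+-identityʳ 1ℚ ⟨
    1ℚ + 0ℚ       ≤⟨ ℚ.+-monoʳ-≤ 1ℚ (fromℕ-nonneg a) ⟩
    1ℚ + fromℕ a  ≤⟨ 1+a≤0 ⟩
    0ℚ            ∎) (ℚ.<-irrefl refl)
    where open ℚ.≤-Reasoning
  fromℕ-cancel-≤ (suc a) (suc b) 1+a≤1+b = ℕ.s≤s (fromℕ-cancel-≤ a b (+-cancelˡ-≤ 1ℚ 1+a≤1+b))

  *-nonneg : ∀ {a b} → 0ℚ ≤ a → 0ℚ ≤ b → 0ℚ ≤ a * b
  *-nonneg {a} {b} 0≤a 0≤b =
    ℚ.nonNegative⁻¹ _ {{ℚ.nonNeg*nonNeg⇒nonNeg a {{ℚ.nonNegative 0≤a}} b {{ℚ.nonNegative 0≤b}}}}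

  square-nonneg : ∀ a → 0ℚ ≤ a * a
  square-nonneg a with ℚ.≤-total 0ℚ a
  ... | inj₁ 0≤a = *-nonneg 0≤a 0≤a
  ... | inj₂ a≤0 =
    ℚ.nonNegative⁻¹ _ {{ℚ.nonPos*nonPos⇒nonPos a {{ℚ.nonPositive a≤0}} a {{ℚ.nonPositive a≤0}}}}

module CubeFunctions where

  open import Data.Rational using (ℚ; 0ℚ; 1ℚ; _+_; _-_; _*_; _≤_)
  import Data.Rational.Properties as ℚ
  open import Data.Rational.Solver using (module +-*-Solver)
  open import Algebra.Properties.CommutativeSemigroup
    (CommutativeRing.+-commutativeSemigroup ℚ.+-*-commutativeRing) using (interchange)
  open +-*-Solver
  open Rationals

  CubeFn : ℕ → Set
  CubeFn n = Vec Bool n → ℚ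

  Δ : CubeFn (suc n) → CubeFn n
  Δ F x = F (true ∷ x) - F (false ∷ x)

  ∂ : Fin n → CubeFn n → CubeFn n
  ∂ j F x = F (x [ j ]≔ true) - F (x [ j ]≔ false)

  ∂-cong : (j : Fin n) {F G : CubeFn n} → F ≗ G → ∂ j F ≗ ∂ j G
  ∂-cong j F≗G x = cong₂ _-_ (F≗G _) (F≗G _)

  ∂-zero : (F : CubeFn (suc n)) → ∂ zero F ≗ Δ F ∘ tail
  ∂-zero F (b ∷ x) = refl

  ∂-Δ : (j : Fin n) (F : CubeFn (suc n)) → ∂ j (Δ F) ≗ Δ (∂ (suc j) F)
  ∂-Δ j F x = solve 4 (λ a b c d → (a :- b) :- (c :- d) := (a :- c) :- (b :- d)) refl
                      (F (true ∷ x [ j ]≔ true)) (F (false ∷ x [ j ]≔ true))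
                      (F (true ∷ x [ j ]≔ false)) (F (false ∷ x [ j ]≔ false))

  cubeSum : CubeFn n → ℚ
  cubeSum {zero} f = f []
  cubeSum {suc n} f = cubeSum (face₀ f) + cubeSum (face₁ f)

  cubeSum-cong : {f g : CubeFn n} → f ≗ g → cubeSum f ≡ cubeSum g
  cubeSum-cong {zero} f≗g = f≗g []
  cubeSum-cong {suc n} f≗g =
    cong₂ _+_ (cubeSum-cong (f≗g ∘ (false ∷_))) (cubeSum-cong (f≗g ∘ (true ∷_)))

  cubeSum-zero : {f : CubeFn n} → (∀ x → f x ≡ 0ℚ) → cubeSum f ≡ 0ℚ
  cubeSum-zero {zero} f≡0 = f≡0 []
  cubeSum-zero {suc n} f≡0 =
    cong₂ _+_ (cubeSum-zero (f≡0 ∘ (false ∷_))) (cubeSum-zero (f≡0 ∘ (true ∷_)))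

  cubeSum-+ : (f g : CubeFn n) → cubeSum (λ x → f x + g x) ≡ cubeSum f + cubeSum g
  cubeSum-+ {zero} f g = refl
  cubeSum-+ {suc n} f g =
    trans (cong₂ _+_ (cubeSum-+ (face₀ f) (face₀ g)) (cubeSum-+ (face₁ f) (face₁ g)))
          (interchange (cubeSum (face₀ f)) (cubeSum (face₀ g)) (cubeSum (face₁ f)) (cubeSum (face₁ g)))

  cubeSum-*ˡ : (c : ℚ) (f : CubeFn n) → cubeSum (λ x → c * f x) ≡ c * cubeSum f
  cubeSum-*ˡ {zero} c f = refl
  cubeSum-*ˡ {suc n} c f =
    trans (cong₂ _+_ (cubeSum-*ˡ c (face₀ f)) (cubeSum-*ˡ c (face₁ f))) (sym (ℚ.*-distribˡ-+ c _ _))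

  cubeSum-nonneg : {f : CubeFn n} → (∀ x → 0ℚ ≤ f x) → 0ℚ ≤ cubeSum f
  cubeSum-nonneg {zero} 0≤f = 0≤f []
  cubeSum-nonneg {suc n} 0≤f =
    ℚ.+-mono-≤ (cubeSum-nonneg (0≤f ∘ (false ∷_))) (cubeSum-nonneg (0≤f ∘ (true ∷_)))

  ‖_‖² : CubeFn n → ℚ
  ‖ F ‖² = cubeSum (λ x → F x * F x)

  ‖‖²-cong : {F G : CubeFn n} → F ≗ G → ‖ F ‖² ≡ ‖ G ‖²
  ‖‖²-cong F≗G = cubeSum-cong (λ x → cong₂ _*_ (F≗G x) (F≗G x))

  ‖‖²-nonneg : (F : CubeFn n) → 0ℚ ≤ ‖ F ‖²
  ‖‖²-nonneg F = cubeSum-nonneg (λ x → square-nonneg (F x))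

  ‖‖²-parallelogram : (F G : CubeFn n) →
    ‖ (λ x → F x + G x) ‖² + ‖ (λ x → F x - G x) ‖² ≡ fromℕ 2 * ‖ F ‖² + fromℕ 2 * ‖ G ‖²
  ‖‖²-parallelogram F G = begin
    ‖ (λ x → F x + G x) ‖² + ‖ (λ x → F x - G x) ‖²
      ≡⟨ cubeSum-+ (λ x → (F x + G x) * (F x + G x)) (λ x → (F x - G x) * (F x - G x)) ⟨
    cubeSum (λ x → (F x + G x) * (F x + G x) + (F x - G x) * (F x - G x))
      ≡⟨ cubeSum-cong (λ x → solve 2 (λ a b → (a :+ b) :* (a :+ b) :+ (a :- b) :* (a :- b)
                                              := con (fromℕ 2) :* (a :* a) :+ con (fromℕ 2) :* (b :* b))
                                     refl (F x) (G x)) ⟩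
    cubeSum (λ x → fromℕ 2 * (F x * F x) + fromℕ 2 * (G x * G x))
      ≡⟨ cubeSum-+ (λ x → fromℕ 2 * (F x * F x)) (λ x → fromℕ 2 * (G x * G x)) ⟩
    cubeSum (λ x → fromℕ 2 * (F x * F x)) + cubeSum (λ x → fromℕ 2 * (G x * G x))
      ≡⟨ cong₂ _+_ (cubeSum-*ˡ (fromℕ 2) (λ x → F x * F x)) (cubeSum-*ˡ (fromℕ 2) (λ x → G x * G x)) ⟩
    fromℕ 2 * ‖ F ‖² + fromℕ 2 * ‖ G ‖² ∎
    where open ≡-Reasoning

  sumℚ-++ : (xs ys : List ℚ) → sumℚ (xs ++ ys) ≡ sumℚ xs + sumℚ ys
  sumℚ-++ [] ys = sym (ℚ.+-identityˡ _)
  sumℚ-++ (x ∷ xs) ys = trans (cong (x +_) (sumℚ-++ xs ys)) (sym (ℚ.+-assoc x _ _))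

  sumℚ-allBoolVecs : (f : CubeFn n) → sumℚ (map f (allBoolVecs n)) ≡ cubeSum f
  sumℚ-allBoolVecs {zero} f = ℚ.+-identityʳ (f [])
  sumℚ-allBoolVecs {suc n} f = begin
    sumℚ (map f (allBoolVecs (suc n)))
      ≡⟨ cong sumℚ (map-allBoolVecs f) ⟩
    sumℚ (map (face₀ f) (allBoolVecs n) ++ map (face₁ f) (allBoolVecs n))
      ≡⟨ sumℚ-++ (map (face₀ f) (allBoolVecs n)) (map (face₁ f) (allBoolVecs n)) ⟩
    sumℚ (map (face₀ f) (allBoolVecs n)) + sumℚ (map (face₁ f) (allBoolVecs n))
      ≡⟨ cong₂ _+_ (sumℚ-allBoolVecs (face₀ f)) (sumℚ-allBoolVecs (face₁ f)) ⟩
    cubeSum f ∎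
    where open ≡-Reasoning

  eval-∷ : (q : MultilinearPoly (suc n)) (b : Bool) (x : Vec Bool n) →
    eval q (b ∷ x) ≡ eval (face₀ q) x + boolToℚ b * eval (face₁ q) x
  eval-∷ {n} q b x = begin
    eval q (b ∷ x)
      ≡⟨ sumℚ-allBoolVecs (λ S → q S * monomial S (b ∷ x)) ⟩
    cubeSum (λ S → q₀ S * (1ℚ * monomial S x)) + cubeSum (λ S → q₁ S * (boolToℚ b * monomial S x))
      ≡⟨ cong₂ _+_ (cubeSum-cong (λ S → cong (q₀ S *_) (ℚ.*-identityˡ _)))
                   (trans (cubeSum-cong (λ S → solve 3 (λ c β m → c :* (β :* m) := β :* (c :* m)) refl
                                                         (q₁ S) (boolToℚ b) (monomial S x)))
                          (cubeSum-*ˡ (boolToℚ b) (λ S → q₁ S * monomial S x))) ⟩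
    cubeSum (λ S → q₀ S * monomial S x) + boolToℚ b * cubeSum (λ S → q₁ S * monomial S x)
      ≡⟨ cong₂ (λ u v → u + boolToℚ b * v) (sumℚ-allBoolVecs (λ S → q₀ S * monomial S x))
                                           (sumℚ-allBoolVecs (λ S → q₁ S * monomial S x)) ⟨
    eval q₀ x + boolToℚ b * eval q₁ x ∎
    where
    open ≡-Reasoning
    q₀ q₁ : MultilinearPoly n
    q₀ = face₀ q
    q₁ = face₁ q

  face₀-eval : (q : MultilinearPoly (suc n)) → face₀ (eval q) ≗ eval (face₀ q)
  face₀-eval q x = begin
    eval q (false ∷ x)                        ≡⟨ eval-∷ q false x ⟩
    eval (face₀ q) x + 0ℚ * eval (face₁ q) x  ≡⟨ cong (eval (face₀ q) x +_) (ℚ.*-zeroˡ (eval (face₁ q) x)) ⟩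
    eval (face₀ q) x + 0ℚ                     ≡⟨ ℚ.+-identityʳ _ ⟩
    eval (face₀ q) x                          ∎
    where open ≡-Reasoning

  Δ-eval : (q : MultilinearPoly (suc n)) → Δ (eval q) ≗ eval (face₁ q)
  Δ-eval q x = trans (cong₂ _-_ (eval-∷ q true x) (face₀-eval q x))
                     (solve 2 (λ a b → (a :+ con 1ℚ :* b) :- a := b) refl (eval (face₀ q) x) (eval (face₁ q) x))

  eval≡0⇒coeffs≡0 : (q : MultilinearPoly n) → (∀ x → eval q x ≡ 0ℚ) → ∀ S → q S ≡ 0ℚ
  eval≡0⇒coeffs≡0 q eval≡0 [] =
    trans (solve 1 (λ c → c := c :* con 1ℚ :+ con 0ℚ) refl (q [])) (eval≡0 [])
  eval≡0⇒coeffs≡0 q eval≡0 (false ∷ S) =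
    eval≡0⇒coeffs≡0 (face₀ q) (λ x → trans (sym (face₀-eval q x)) (eval≡0 (false ∷ x))) S
  eval≡0⇒coeffs≡0 q eval≡0 (true ∷ S) =
    eval≡0⇒coeffs≡0 (face₁ q)
      (λ x → trans (sym (Δ-eval q x)) (cong₂ _-_ (eval≡0 (true ∷ x)) (eval≡0 (false ∷ x)))) S

module Degree where

  open import Data.Empty using (⊥-elim)
  open import Data.Nat as ℕ using (_≤_; _<_; z≤n; s≤s)
  import Data.Nat.Properties as ℕ
  open import Data.Rational using (ℚ; 0ℚ; _+_; _-_; _*_; _≟_)
  import Data.Rational.Properties as ℚ
  open import Data.Rational.Solver using (module +-*-Solver)
  open import Relation.Nullary using (¬_; yes; no)
  open import Algebra.Properties.AbelianGroup ℚ.+-0-abelianGroup using (x∙y⁻¹≈ε⇒x≈y; x≈y⇒x∙y⁻¹≈ε)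
  open +-*-Solver
  open CubeFunctions

  private variable
    D D′ : ℕ
    F G : CubeFn n

  -- F has degree < D as a multilinear polynomial, read off from F = face₀ F + x₀ · Δ F.
  data DegreeBelow : ℕ → CubeFn n → Set where
    vanishes : (∀ x → F x ≡ 0ℚ) → DegreeBelow zero F
    point    : {F : CubeFn zero} → DegreeBelow (suc D) F
    split    : {F : CubeFn (suc n)} →
               DegreeBelow (suc D) (face₀ F) → DegreeBelow D (Δ F) → DegreeBelow (suc D) F

  DegreeBelow-cong : F ≗ G → DegreeBelow D F → DegreeBelow D G
  DegreeBelow-cong F≗G (vanishes F≡0) = vanishes (λ x → trans (sym (F≗G x)) (F≡0 x))
  DegreeBelow-cong F≗G point = point
  DegreeBelow-cong F≗G (split h₀ h₁) =
    split (DegreeBelow-cong (F≗G ∘ (false ∷_)) h₀) (DegreeBelow-cong (λ x → cong₂ _-_ (F≗G _) (F≗G _)) h₁)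

  vanishes⇒DegreeBelow : {F : CubeFn n} → (∀ x → F x ≡ 0ℚ) → DegreeBelow D F
  vanishes⇒DegreeBelow {D = zero} F≡0 = vanishes F≡0
  vanishes⇒DegreeBelow {n = zero} {D = suc D} F≡0 = point
  vanishes⇒DegreeBelow {n = suc n} {D = suc D} F≡0 =
    split (vanishes⇒DegreeBelow (F≡0 ∘ (false ∷_)))
          (vanishes⇒DegreeBelow (λ x → cong₂ _-_ (F≡0 (true ∷ x)) (F≡0 (false ∷ x))))

  DegreeBelow-mono : D ≤ D′ → DegreeBelow D F → DegreeBelow D′ F
  DegreeBelow-mono z≤n (vanishes F≡0) = vanishes⇒DegreeBelow F≡0
  DegreeBelow-mono (s≤s D≤D′) point = point
  DegreeBelow-mono (s≤s D≤D′) (split h₀ h₁) =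
    split (DegreeBelow-mono (s≤s D≤D′) h₀) (DegreeBelow-mono D≤D′ h₁)

  DegreeBelow-+ : DegreeBelow D F → DegreeBelow D G → DegreeBelow D (λ x → F x + G x)
  DegreeBelow-+ (vanishes F≡0) (vanishes G≡0) = vanishes (λ x → cong₂ _+_ (F≡0 x) (G≡0 x))
  DegreeBelow-+ point point = point
  DegreeBelow-+ {F = F} {G = G} (split h₀ h₁) (split k₀ k₁) =
    split (DegreeBelow-+ h₀ k₀)
          (DegreeBelow-cong (λ x → solve 4 (λ a b c d → (a :- c) :+ (b :- d) := (a :+ b) :- (c :+ d)) refl
                                             (F (true ∷ x)) (G (true ∷ x)) (F (false ∷ x)) (G (false ∷ x)))
                            (DegreeBelow-+ h₁ k₁))

  DegreeBelow-*ʳ : (c : ℚ) → DegreeBelow D F → DegreeBelow D (λ x → F x * c)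
  DegreeBelow-*ʳ c (vanishes F≡0) = vanishes (λ x → trans (cong (_* c) (F≡0 x)) (ℚ.*-zeroˡ c))
  DegreeBelow-*ʳ c point = point
  DegreeBelow-*ʳ {F = F} c (split h₀ h₁) =
    split (DegreeBelow-*ʳ c h₀)
          (DegreeBelow-cong (λ x → solve 3 (λ a b c → (a :- b) :* c := a :* c :- b :* c) refl
                                             (F (true ∷ x)) (F (false ∷ x)) c)
                            (DegreeBelow-*ʳ c h₁))

  DegreeBelow-const : (c : ℚ) → DegreeBelow 1 (λ (_ : Vec Bool n) → c)
  DegreeBelow-const {n = zero} c = point
  DegreeBelow-const {n = suc n} c = split (DegreeBelow-const c) (vanishes (λ _ → ℚ.+-inverseʳ c))

  DegreeBelow-face₁ : {F : CubeFn (suc n)} → DegreeBelow D F → DegreeBelow D (face₁ F)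
  DegreeBelow-face₁ (vanishes F≡0) = vanishes (F≡0 ∘ (true ∷_))
  DegreeBelow-face₁ {F = F} (split h₀ h₁) =
    DegreeBelow-cong (λ x → solve 2 (λ a b → b :+ (a :- b) := a) refl (F (true ∷ x)) (F (false ∷ x)))
                     (DegreeBelow-+ h₀ (DegreeBelow-mono (ℕ.n≤1+n _) h₁))

  DegreeBelow-* : DegreeBelow D F → DegreeBelow (suc D′) G → DegreeBelow (D ℕ.+ D′) (λ x → F x * G x)
  DegreeBelow-* {G = G} (vanishes F≡0) _ =
    vanishes⇒DegreeBelow (λ x → trans (cong (_* G x) (F≡0 x)) (ℚ.*-zeroˡ (G x)))
  DegreeBelow-* point point = point
  DegreeBelow-* {D = suc D} {F = F} {D′ = D′} {G = G} (split h₀ h₁) k@(split k₀ k₁) =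
    split (DegreeBelow-* h₀ k₀)
          (DegreeBelow-cong product-rule (DegreeBelow-+ (DegreeBelow-* h₁ (DegreeBelow-face₁ k)) F₀ΔG))
    where
    F₀ΔG : DegreeBelow (D ℕ.+ D′) (λ x → F (false ∷ x) * Δ G x)
    F₀ΔG = subst (λ e → DegreeBelow e (λ x → F (false ∷ x) * Δ G x)) (ℕ.+-comm D′ D)
                 (DegreeBelow-cong (λ x → ℚ.*-comm (Δ G x) (F (false ∷ x))) (DegreeBelow-* k₁ h₀))
    product-rule : ∀ x → Δ F x * G (true ∷ x) + F (false ∷ x) * Δ G x ≡ Δ (λ y → F y * G y) x
    product-rule x =
      solve 4 (λ f₁ f₀ g₁ g₀ → (f₁ :- f₀) :* g₁ :+ f₀ :* (g₁ :- g₀) := f₁ :* g₁ :- f₀ :* g₀) refl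
              (F (true ∷ x)) (F (false ∷ x)) (G (true ∷ x)) (G (false ∷ x))

  DegreeBelow-1⇒constant : DegreeBelow 1 F → ∀ x y → F x ≡ F y
  DegreeBelow-1⇒constant point [] [] = refl
  DegreeBelow-1⇒constant {F = F} (split h₀ (vanishes ΔF≡0)) (b ∷ x) (c ∷ y) =
    trans (to-face₀ b x) (trans (DegreeBelow-1⇒constant h₀ x y) (sym (to-face₀ c y)))
    where
    to-face₀ : ∀ b x → F (b ∷ x) ≡ F (false ∷ x)
    to-face₀ false x = refl
    to-face₀ true x = x∙y⁻¹≈ε⇒x≈y (F (true ∷ x)) (F (false ∷ x)) (ΔF≡0 x)

  DegreeBelow-∘tail : DegreeBelow D F → DegreeBelow D (F ∘ tail)
  DegreeBelow-∘tail {D = zero} (vanishes F≡0) = vanishes (F≡0 ∘ tail)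
  DegreeBelow-∘tail {D = suc D} {F = F} h = split h (vanishes⇒DegreeBelow (λ x → ℚ.+-inverseʳ (F x)))

  DegreeBelow-∂ : (j : Fin n) → DegreeBelow (suc D) F → DegreeBelow D (∂ j F)
  DegreeBelow-∂ {D = zero} j h = vanishes (λ x → x≈y⇒x∙y⁻¹≈ε (DegreeBelow-1⇒constant h _ _))
  DegreeBelow-∂ {D = suc D} {F = F} zero (split h₀ h₁) =
    DegreeBelow-cong (λ x → sym (∂-zero F x)) (DegreeBelow-∘tail h₁)
  DegreeBelow-∂ {D = suc D} {F = F} (suc j) (split h₀ h₁) =
    split (DegreeBelow-∂ j h₀) (DegreeBelow-cong (∂-Δ j F) (DegreeBelow-∂ j h₁))

  DegreeBelow-eval : (q : MultilinearPoly n) → (∀ S → ¬ q S ≡ 0ℚ → card S < D) → DegreeBelow D (eval q)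
  DegreeBelow-eval {D = zero} q card<0 =
    vanishes (λ x → trans (sumℚ-allBoolVecs (λ S → q S * monomial S x))
                          (cubeSum-zero (λ S → trans (cong (_* monomial S x) (q≡0 S)) (ℚ.*-zeroˡ (monomial S x)))))
    where
    q≡0 : ∀ S → q S ≡ 0ℚ
    q≡0 S with q S ≟ 0ℚ
    ... | yes q≡0 = q≡0
    ... | no q≢0 = ⊥-elim (ℕ.n≮0 (card<0 S q≢0))
  DegreeBelow-eval {n = zero} {D = suc D} q _ = point
  DegreeBelow-eval {n = suc n} {D = suc D} q card<D =
    split (DegreeBelow-cong (λ x → sym (face₀-eval q x))
                            (DegreeBelow-eval (face₀ q) (λ S → card<D (false ∷ S))))
          (DegreeBelow-cong (λ x → sym (Δ-eval q x))
                            (DegreeBelow-eval (face₁ q) (λ S q≢0 → ℕ.≤-pred (card<D (true ∷ S) q≢0))))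

module Energy where

  open import Data.Nat.Properties using (n≤1+n)
  open import Data.Rational using (ℚ; 0ℚ; 1ℚ; ½; -½; _+_; _-_; _*_; _≤_)
  import Data.Rational.Properties as ℚ
  open import Data.Rational.Solver using (module +-*-Solver)
  open import Algebra.Properties.Semiring.Sum (CommutativeRing.semiring ℚ.+-*-commutativeRing)
    using (sum-syntax; sum-cong-≗; sum-replicate-zero; ∑-distrib-+; *-distribˡ-sum)
  open +-*-Solver
  open Rationals
  open CubeFunctions
  open Degree

  energy : CubeFn n → ℚ
  energy {n} F = ∑[ j < n ] ‖ ∂ j F ‖²

  energy-cong : {F G : CubeFn n} → F ≗ G → energy F ≡ energy G
  energy-cong F≗G = sum-cong-≗ (λ j → ‖‖²-cong (∂-cong j F≗G))

  energy-vanishes : {F : CubeFn n} → (∀ x → F x ≡ 0ℚ) → energy F ≡ 0ℚ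
  energy-vanishes {n} {F} F≡0 =
    trans (sum-cong-≗ (λ j → cubeSum-zero (λ x → cong₂ _*_ (∂F≡0 j x) (∂F≡0 j x)))) (sum-replicate-zero n)
    where
    ∂F≡0 : ∀ j x → ∂ j F x ≡ 0ℚ
    ∂F≡0 j x = cong₂ _-_ (F≡0 _) (F≡0 _)

  energy-suc : (F : CubeFn (suc n)) →
    energy F ≡ (‖ Δ F ‖² + ‖ Δ F ‖²) + (energy (face₀ F) + energy (face₁ F))
  energy-suc F =
    cong (‖ Δ F ‖² + ‖ Δ F ‖² +_)
         (∑-distrib-+ (λ j → ‖ ∂ j (face₀ F) ‖²) (λ j → ‖ ∂ j (face₁ F) ‖²))

  energy-parallelogram : (F G : CubeFn n) →
    energy (λ x → F x + G x) + energy (λ x → F x - G x) ≡ fromℕ 2 * energy F + fromℕ 2 * energy G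
  energy-parallelogram {n} F G = begin
    energy F+G + energy F-G
      ≡⟨ ∑-distrib-+ (λ j → ‖ ∂ j F+G ‖²) (λ j → ‖ ∂ j F-G ‖²) ⟨
    ∑[ j < n ] (‖ ∂ j F+G ‖² + ‖ ∂ j F-G ‖²)
      ≡⟨ sum-cong-≗ (λ j → trans (cong₂ _+_ (‖‖²-cong (∂-sum j)) (‖‖²-cong (∂-difference j)))
                                 (‖‖²-parallelogram (∂ j F) (∂ j G))) ⟩
    ∑[ j < n ] (fromℕ 2 * ‖ ∂ j F ‖² + fromℕ 2 * ‖ ∂ j G ‖²)
      ≡⟨ ∑-distrib-+ (λ j → fromℕ 2 * ‖ ∂ j F ‖²) (λ j → fromℕ 2 * ‖ ∂ j G ‖²) ⟩
    ∑[ j < n ] (fromℕ 2 * ‖ ∂ j F ‖²) + ∑[ j < n ] (fromℕ 2 * ‖ ∂ j G ‖²)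
      ≡⟨ cong₂ _+_ (*-distribˡ-sum (fromℕ 2) (λ j → ‖ ∂ j F ‖²))
                   (*-distribˡ-sum (fromℕ 2) (λ j → ‖ ∂ j G ‖²)) ⟨
    fromℕ 2 * energy F + fromℕ 2 * energy G ∎
    where
    open ≡-Reasoning
    F+G F-G : CubeFn n
    F+G x = F x + G x
    F-G x = F x - G x
    ∂-sum : ∀ j → ∂ j F+G ≗ (λ x → ∂ j F x + ∂ j G x)
    ∂-sum j x = solve 4 (λ a b c d → (a :+ b) :- (c :+ d) := (a :- c) :+ (b :- d)) refl
                      (F (x [ j ]≔ true)) (G (x [ j ]≔ true)) (F (x [ j ]≔ false)) (G (x [ j ]≔ false))
    ∂-difference : ∀ j → ∂ j F-G ≗ (λ x → ∂ j F x - ∂ j G x)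
    ∂-difference j x = solve 4 (λ a b c d → (a :- b) :- (c :- d) := (a :- c) :- (b :- d)) refl
                      (F (x [ j ]≔ true)) (G (x [ j ]≔ true)) (F (x [ j ]≔ false)) (G (x [ j ]≔ false))

  -- A Poincaré-type inequality. Splitting F into its even and odd parts A and B in the first
  -- variable gives face₀ F = A + B, face₁ F = A - B and Δ F = - 2 B, where B has lower degree.
  energy-bound : ∀ {n e} {F : CubeFn n} → DegreeBelow e F → energy F ≤ fromℕ 4 * fromℕ e * ‖ F ‖²
  energy-bound {F = F} (vanishes F≡0) =
    ℚ.≤-reflexive (trans (energy-vanishes F≡0) (sym (ℚ.*-zeroˡ ‖ F ‖²)))
  energy-bound {e = e} {F} point = *-nonneg (*-nonneg (fromℕ-nonneg 4) (fromℕ-nonneg e)) (‖‖²-nonneg F)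
  energy-bound {suc n} {suc e} {F} (split h₀ h₁) = begin
    energy F
      ≡⟨ energy-suc F ⟩
    (‖ Δ F ‖² + ‖ Δ F ‖²) + (energy (face₀ F) + energy (face₁ F))
      ≡⟨ cong₂ _+_ (cong₂ _+_ ‖ΔF‖² ‖ΔF‖²) (cong₂ _+_ (energy-cong A+B) (energy-cong A-B)) ⟩
    4‖B‖²+4‖B‖² + (energy (λ x → A x + B x) + energy (λ x → A x - B x))
      ≡⟨ cong (4‖B‖²+4‖B‖² +_) (energy-parallelogram A B) ⟩
    4‖B‖²+4‖B‖² + (fromℕ 2 * energy A + fromℕ 2 * energy B)
      ≤⟨ ℚ.+-monoʳ-≤ 4‖B‖²+4‖B‖²
           (ℚ.+-mono-≤ (2*-mono (energy-bound hA)) (2*-mono (energy-bound hB))) ⟩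
    4‖B‖²+4‖B‖² + (fromℕ 2 * (fromℕ 4 * fromℕ (suc e) * ‖ A ‖²)
                    + fromℕ 2 * (fromℕ 4 * fromℕ e * ‖ B ‖²))
      ≡⟨ solve 3 (λ E a b → (con (fromℕ 4) :* b :+ con (fromℕ 4) :* b)
                            :+ (con (fromℕ 2) :* (con (fromℕ 4) :* (con 1ℚ :+ E) :* a)
                                :+ con (fromℕ 2) :* (con (fromℕ 4) :* E :* b))
                            := con (fromℕ 4) :* (con 1ℚ :+ E) :* (con (fromℕ 2) :* a :+ con (fromℕ 2) :* b))
                 refl (fromℕ e) ‖ A ‖² ‖ B ‖² ⟩
    fromℕ 4 * fromℕ (suc e) * (fromℕ 2 * ‖ A ‖² + fromℕ 2 * ‖ B ‖²)
      ≡⟨ cong (fromℕ 4 * fromℕ (suc e) *_) ‖F‖² ⟨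
    fromℕ 4 * fromℕ (suc e) * ‖ F ‖² ∎
    where
    open ℚ.≤-Reasoning
    A B : CubeFn n
    A x = (F (false ∷ x) + F (true ∷ x)) * ½
    B x = (F (false ∷ x) - F (true ∷ x)) * ½
    4‖B‖²+4‖B‖² : ℚ
    4‖B‖²+4‖B‖² = fromℕ 4 * ‖ B ‖² + fromℕ 4 * ‖ B ‖²
    2*-mono : ∀ {p q} → p ≤ q → fromℕ 2 * p ≤ fromℕ 2 * q
    2*-mono = ℚ.*-monoˡ-≤-nonNeg (fromℕ 2)
    hA : DegreeBelow (suc e) A
    hA = DegreeBelow-cong (λ x → solve 2 (λ f₀ f₁ → f₀ :+ (f₁ :- f₀) :* con ½ := (f₀ :+ f₁) :* con ½) refl
                                           (F (false ∷ x)) (F (true ∷ x)))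
                          (DegreeBelow-+ h₀ (DegreeBelow-mono (n≤1+n e) (DegreeBelow-*ʳ ½ h₁)))
    hB : DegreeBelow e B
    hB = DegreeBelow-cong (λ x → solve 2 (λ f₀ f₁ → (f₁ :- f₀) :* con -½ := (f₀ :- f₁) :* con ½) refl
                                           (F (false ∷ x)) (F (true ∷ x)))
                          (DegreeBelow-*ʳ -½ h₁)
    A+B : face₀ F ≗ (λ x → A x + B x)
    A+B x = solve 2 (λ f₀ f₁ → f₀ := (f₀ :+ f₁) :* con ½ :+ (f₀ :- f₁) :* con ½) refl
                    (F (false ∷ x)) (F (true ∷ x))
    A-B : face₁ F ≗ (λ x → A x - B x)
    A-B x = solve 2 (λ f₀ f₁ → f₁ := (f₀ :+ f₁) :* con ½ :- (f₀ :- f₁) :* con ½) refl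
                    (F (false ∷ x)) (F (true ∷ x))
    ‖ΔF‖² : ‖ Δ F ‖² ≡ fromℕ 4 * ‖ B ‖²
    ‖ΔF‖² = trans (cubeSum-cong (λ x → solve 2 (λ f₀ f₁ → (f₁ :- f₀) :* (f₁ :- f₀)
                                                   := con (fromℕ 4) :* ((f₀ :- f₁) :* con ½ :* ((f₀ :- f₁) :* con ½)))
                                                refl (F (false ∷ x)) (F (true ∷ x))))
                  (cubeSum-*ˡ (fromℕ 4) (λ x → B x * B x))
    ‖F‖² : ‖ F ‖² ≡ fromℕ 2 * ‖ A ‖² + fromℕ 2 * ‖ B ‖²
    ‖F‖² = trans (cong₂ _+_ (‖‖²-cong A+B) (‖‖²-cong A-B)) (‖‖²-parallelogram A B)

module Interpolation where

  open import Data.List using (length)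
  open import Data.List.Relation.Unary.Any using (there)
  open import Data.Nat as ℕ using (s≤s; z≤n)
  import Data.Nat.Properties as ℕ
  open import Data.Rational using (ℚ; 0ℚ; 1ℚ; _-_; _*_; 1/_; -_; _≟_; NonZero; ≢-nonZero)
  import Data.Rational.Properties as ℚ
  open import Data.Sum using (_⊎_)
  open import Relation.Nullary using (¬_; yes; no; contradiction)
  open import Algebra.Properties.AbelianGroup ℚ.+-0-abelianGroup using (x∙y⁻¹≈ε⇒x≈y)
  open CubeFunctions
  open Degree

  Boolean : CubeFn n → Set
  Boolean g = ∀ x → g x ≡ 0ℚ ⊎ g x ≡ 1ℚ

  module _ {u v : ℚ} (u≢v : ¬ u ≡ v) where

    private instance
      v-u≢0 : NonZero (v - u)
      v-u≢0 = ≢-nonZero (u≢v ∘ sym ∘ x∙y⁻¹≈ε⇒x≈y v u)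

    lagrangeFactor : ℚ → ℚ
    lagrangeFactor y = (y - u) * 1/ (v - u)

    lagrangeFactor-at-v : lagrangeFactor v ≡ 1ℚ
    lagrangeFactor-at-v = ℚ.*-inverseʳ (v - u)

    lagrangeFactor-at-u : lagrangeFactor u ≡ 0ℚ
    lagrangeFactor-at-u = trans (cong (_* 1/ (v - u)) (ℚ.+-inverseʳ u)) (ℚ.*-zeroˡ (1/ (v - u)))

  lagrange : List ℚ → ℚ → ℚ → ℚ
  lagrange [] v y = 1ℚ
  lagrange (u ∷ L) v y with u ≟ v
  ... | yes _ = lagrange L v y
  ... | no u≢v = lagrangeFactor u≢v y * lagrange L v y

  lagrange-at-node : (L : List ℚ) (v : ℚ) → lagrange L v v ≡ 1ℚ
  lagrange-at-node [] v = refl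
  lagrange-at-node (u ∷ L) v with u ≟ v
  ... | yes _ = lagrange-at-node L v
  ... | no u≢v = trans (cong₂ _*_ (lagrangeFactor-at-v u≢v) (lagrange-at-node L v)) (ℚ.*-identityˡ 1ℚ)

  lagrange-at-other-node : (L : List ℚ) {v w : ℚ} → w ∈ L → ¬ w ≡ v → lagrange L v w ≡ 0ℚ
  lagrange-at-other-node (u ∷ L) {v} (here refl) w≢v with u ≟ v
  ... | yes u≡v = contradiction u≡v w≢v
  ... | no u≢v =
    trans (cong (_* lagrange L v u) (lagrangeFactor-at-u u≢v)) (ℚ.*-zeroˡ (lagrange L v u))
  lagrange-at-other-node (u ∷ L) {v} {w} (there w∈L) w≢v with u ≟ v
  ... | yes _ = lagrange-at-other-node L w∈L w≢v
  ... | no u≢v =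
    trans (cong (lagrangeFactor u≢v w *_) (lagrange-at-other-node L w∈L w≢v)) (ℚ.*-zeroʳ (lagrangeFactor u≢v w))

  DegreeBelow-lagrange : ∀ {d} {F : CubeFn n} (L : List ℚ) (v : ℚ) →
    DegreeBelow (suc d) F → DegreeBelow (suc (length L ℕ.* d)) (λ x → lagrange L v (F x))
  DegreeBelow-lagrange [] v hF = DegreeBelow-mono (s≤s z≤n) (DegreeBelow-const 1ℚ)
  DegreeBelow-lagrange {d = d} (u ∷ L) v hF with u ≟ v
  ... | yes _ = DegreeBelow-mono (s≤s (ℕ.m≤n+m _ d)) (DegreeBelow-lagrange L v hF)
  ... | no u≢v =
    DegreeBelow-* (DegreeBelow-*ʳ _ (DegreeBelow-+ hF (DegreeBelow-mono (s≤s z≤n) (DegreeBelow-const (- u)))))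
                  (DegreeBelow-lagrange L v hF)

  module _ {F : CubeFn n} {L : List ℚ} (F∈L : ∀ x → F x ∈ L) where

    lagrange-boolean : (v : ℚ) → Boolean (λ x → lagrange L v (F x))
    lagrange-boolean v x with F x ≟ v
    ... | yes refl = inj₂ (lagrange-at-node L (F x))
    ... | no Fx≢v = inj₁ (lagrange-at-other-node L (F∈L x) Fx≢v)

    lagrange-separates : ∀ {v} x y → F x ≡ v → ¬ F x ≡ F y → ¬ lagrange L v (F x) ≡ lagrange L v (F y)
    lagrange-separates x y refl Fx≢Fy eq =
      1≢0 (trans (sym (lagrange-at-node L (F x))) (trans eq (lagrange-at-other-node L (F∈L y) (Fx≢Fy ∘ sym))))
      where
      1≢0 : ¬ 1ℚ ≡ 0ℚ
      1≢0 ()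

open import Data.Nat using (_+_; _*_; _^_; _≤_; _<_; z≤n; s≤s)
import Data.Nat as ℕ using (_≟_)
import Data.Nat.Properties as ℕ
open import Data.Nat.Solver using (module +-*-Solver)
open import Data.List using (length; filter; deduplicate; lookup)
open import Data.List.Properties using (filter-++; length-++)
open import Data.List.Membership.Propositional.Properties using (∈-deduplicate⁺)
open import Data.List.Relation.Unary.Any using (index)
open import Data.List.Relation.Unary.Any.Properties using (lookup-index)
open import Data.Product using (∃-syntax)
open import Data.Rational as ℚ using (ℚ; 0ℚ; 1ℚ)
import Data.Rational.Properties as ℚ
open import Relation.Nullary using (¬_; yes; no; does; contradiction)
open import Relation.Nullary.Decidable using (¬?)
open import Relation.Unary using (Decidable)
open import Algebra.Properties.AbelianGroup ℚ.+-0-abelianGroup using (x∙y⁻¹≈ε⇒x≈y; x≈y⇒x∙y⁻¹≈ε)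
open import Algebra.Properties.CommutativeSemigroup ℕ.+-commutativeSemigroup using (interchange)
open import Algebra.Properties.Semiring.Sum ℕ.+-*-semiring
  using (sum-syntax; sum-cong-≗; ∑-distrib-+; ∑-comm; *-distribˡ-sum; *-distribʳ-sum)
import Algebra.Properties.Semiring.Sum (CommutativeRing.semiring ℚ.+-*-commutativeRing) as ℚΣ
open +-*-Solver
open Rationals
open CubeFunctions
open Degree
open Energy
open Interpolation

private variable
  m c D e : ℕ

∑-mono-≤ : ∀ {k} {f g : Fin k → ℕ} → (∀ i → f i ≤ g i) → ∑[ i < k ] f i ≤ ∑[ i < k ] g i
∑-mono-≤ {zero} _ = z≤n
∑-mono-≤ {suc k} f≤g = ℕ.+-mono-≤ (f≤g zero) (∑-mono-≤ (f≤g ∘ suc))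

≤-∑ : ∀ {k} (f : Fin k → ℕ) (i : Fin k) → f i ≤ ∑[ j < k ] f j
≤-∑ f zero = ℕ.m≤m+n _ _
≤-∑ f (suc i) = ℕ.≤-trans (≤-∑ (f ∘ suc) i) (ℕ.m≤n+m _ (f zero))

∑-≤-* : ∀ {k} {f : Fin k → ℕ} → (∀ i → f i ≤ c) → ∑[ i < k ] f i ≤ k * c
∑-≤-* {k = zero} _ = z≤n
∑-≤-* {k = suc k} f≤c = ℕ.+-mono-≤ (f≤c zero) (∑-≤-* (f≤c ∘ suc))

signum : ℕ → ℕ
signum zero = 0
signum (suc _) = 1

∑-signum-mono : ∀ {k} {f g : Fin k → ℕ} → (∀ i → 0 < f i → 0 < g i) →
  ∑[ i < k ] signum (f i) ≤ ∑[ i < k ] signum (g i)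
∑-signum-mono {f = f} {g} pos⇒pos = ∑-mono-≤ (λ i → signum-mono (f i) (g i) (pos⇒pos i))
  where
  signum-mono : ∀ a b → (0 < a → 0 < b) → signum a ≤ signum b
  signum-mono zero b _ = z≤n
  signum-mono (suc a) zero pos⇒pos = contradiction (pos⇒pos (s≤s z≤n)) (λ ())
  signum-mono (suc a) (suc b) _ = s≤s z≤n

∑-signum-*-≤ : ∀ {k} {f : Fin k → ℕ} → (∀ i → 0 < f i → m ≤ c * f i) →
  (∑[ i < k ] signum (f i)) * m ≤ c * ∑[ i < k ] f i
∑-signum-*-≤ {m = m} {c} {k} {f} bound = begin
  (∑[ i < k ] signum (f i)) * m ≡⟨ *-distribʳ-sum m (λ i → signum (f i)) ⟩
  ∑[ i < k ] (signum (f i) * m) ≤⟨ ∑-mono-≤ (λ i → signum-*-≤ (f i) (bound i)) ⟩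
  ∑[ i < k ] (c * f i)          ≡⟨ *-distribˡ-sum c f ⟨
  c * ∑[ i < k ] f i            ∎
  where
  open ℕ.≤-Reasoning
  signum-*-≤ : ∀ a → (0 < a → m ≤ c * a) → signum a * m ≤ c * a
  signum-*-≤ zero _ = z≤n
  signum-*-≤ (suc a) bound = ℕ.≤-trans (ℕ.≤-reflexive (ℕ.+-identityʳ m)) (bound (s≤s z≤n))

-- Counting nonzero values; the Schwartz–Zippel bound

nonzeroIndicator : ℚ → ℕ
nonzeroIndicator a with a ℚ.≟ 0ℚ
... | yes _ = 0
... | no _ = 1

nonzeroIndicator≤1 : ∀ a → nonzeroIndicator a ≤ 1
nonzeroIndicator≤1 a with a ℚ.≟ 0ℚ
... | yes _ = z≤n
... | no _ = s≤s z≤n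

nonzeroIndicator-≡0 : ∀ {a} → a ≡ 0ℚ → nonzeroIndicator a ≡ 0
nonzeroIndicator-≡0 {a} a≡0 with a ℚ.≟ 0ℚ
... | yes _ = refl
... | no a≢0 = contradiction a≡0 a≢0

nonzeroIndicator-≢0 : ∀ {a} → ¬ a ≡ 0ℚ → nonzeroIndicator a ≡ 1
nonzeroIndicator-≢0 {a} a≢0 with a ℚ.≟ 0ℚ
... | yes a≡0 = contradiction a≡0 a≢0
... | no _ = refl

nonzeros : CubeFn n → ℕ
nonzeros {zero} F = nonzeroIndicator (F [])
nonzeros {suc n} F = nonzeros (face₀ F) + nonzeros (face₁ F)

nonzeros-cong : {F G : CubeFn n} → F ≗ G → nonzeros F ≡ nonzeros G
nonzeros-cong {zero} F≗G = cong nonzeroIndicator (F≗G [])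
nonzeros-cong {suc n} F≗G =
  cong₂ _+_ (nonzeros-cong (F≗G ∘ (false ∷_))) (nonzeros-cong (F≗G ∘ (true ∷_)))

≡0⇒nonzeros≡0 : {F : CubeFn n} → (∀ x → F x ≡ 0ℚ) → nonzeros F ≡ 0
≡0⇒nonzeros≡0 {zero} F≡0 = nonzeroIndicator-≡0 (F≡0 [])
≡0⇒nonzeros≡0 {suc n} F≡0 =
  cong₂ _+_ (≡0⇒nonzeros≡0 (F≡0 ∘ (false ∷_))) (≡0⇒nonzeros≡0 (F≡0 ∘ (true ∷_)))

≢0⇒nonzeros>0 : {F : CubeFn n} (x : Vec Bool n) → ¬ F x ≡ 0ℚ → 0 < nonzeros F
≢0⇒nonzeros>0 [] Fx≢0 = ℕ.≤-reflexive (sym (nonzeroIndicator-≢0 Fx≢0))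
≢0⇒nonzeros>0 (false ∷ x) Fx≢0 = ℕ.<-≤-trans (≢0⇒nonzeros>0 x Fx≢0) (ℕ.m≤m+n _ _)
≢0⇒nonzeros>0 (true ∷ x) Fx≢0 = ℕ.<-≤-trans (≢0⇒nonzeros>0 x Fx≢0) (ℕ.m≤n+m _ _)

nonzeros≡0⇒≡0 : {F : CubeFn n} → nonzeros F ≡ 0 → ∀ x → F x ≡ 0ℚ
nonzeros≡0⇒≡0 {F = F} nonzeros≡0 x with F x ℚ.≟ 0ℚ
... | yes Fx≡0 = Fx≡0
... | no Fx≢0 = contradiction nonzeros≡0 (ℕ.>⇒≢ (≢0⇒nonzeros>0 x Fx≢0))

nonzeros≤2^n : (F : CubeFn n) → nonzeros F ≤ 2 ^ n
nonzeros≤2^n {zero} F = nonzeroIndicator≤1 (F [])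
nonzeros≤2^n {suc n} F =
  ℕ.+-mono-≤ (nonzeros≤2^n (face₀ F))
             (ℕ.≤-trans (nonzeros≤2^n (face₁ F)) (ℕ.≤-reflexive (sym (ℕ.+-identityʳ _))))

nonzeros-sub : (F G : CubeFn n) → nonzeros (λ x → F x ℚ.- G x) ≤ nonzeros F + nonzeros G
nonzeros-sub {zero} F G = nonzeroIndicator-sub (F []) (G [])
  where
  nonzeroIndicator-sub : ∀ a b → nonzeroIndicator (a ℚ.- b) ≤ nonzeroIndicator a + nonzeroIndicator b
  nonzeroIndicator-sub a b with a ℚ.≟ 0ℚ | b ℚ.≟ 0ℚ
  ... | yes refl | yes refl = z≤n
  ... | yes _ | no _ = nonzeroIndicator≤1 (a ℚ.- b)
  ... | no _ | _ = ℕ.≤-trans (nonzeroIndicator≤1 (a ℚ.- b)) (s≤s z≤n)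
nonzeros-sub {suc n} F G =
  ℕ.≤-trans (ℕ.+-mono-≤ (nonzeros-sub (face₀ F) (face₀ G)) (nonzeros-sub (face₁ F) (face₁ G)))
            (ℕ.≤-reflexive (interchange (nonzeros (face₀ F)) (nonzeros (face₀ G))
                                        (nonzeros (face₁ F)) (nonzeros (face₁ G))))

nonzeros-cover : ∀ {k} {G : CubeFn n} (H : Fin k → CubeFn n) →
  (∀ x → ¬ G x ≡ 0ℚ → ∃[ i ] ¬ H i x ≡ 0ℚ) → nonzeros G ≤ ∑[ i < k ] nonzeros (H i)
nonzeros-cover {zero} {G = G} H cover with G [] ℚ.≟ 0ℚ
... | yes _ = z≤n
... | no G≢0 with cover [] G≢0
...   | i , Hi≢0 =
  ℕ.≤-trans (ℕ.≤-reflexive (sym (nonzeroIndicator-≢0 Hi≢0))) (≤-∑ (λ i → nonzeros (H i)) i)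
nonzeros-cover {suc n} H cover =
  ℕ.≤-trans (ℕ.+-mono-≤ (nonzeros-cover (λ i → face₀ (H i)) (cover ∘ (false ∷_)))
                        (nonzeros-cover (λ i → face₁ (H i)) (cover ∘ (true ∷_))))
            (ℕ.≤-reflexive (sym (∑-distrib-+ (λ i → nonzeros (face₀ (H i))) (λ i → nonzeros (face₁ (H i))))))

schwartz-zippel : {G : CubeFn n} → DegreeBelow D G → 0 < nonzeros G → 2 * 2 ^ n ≤ 2 ^ D * nonzeros G
schwartz-zippel (vanishes G≡0) pos = contradiction (≡0⇒nonzeros≡0 G≡0) (ℕ.>⇒≢ pos)
schwartz-zippel {D = suc D} point pos = ℕ.*-mono-≤ (ℕ.*-monoʳ-≤ 2 (ℕ.m^n>0 2 D)) pos
schwartz-zippel {suc n} {suc D} {G} (split h₀ h₁) pos with nonzeros (Δ G) ℕ.≟ 0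
... | yes ΔG≡0 = begin
  2 * (2 * 2 ^ n)                         ≤⟨ ℕ.*-monoʳ-≤ 2 (schwartz-zippel h₀ pos₀) ⟩
  2 * (2 ^ suc D * nonzeros G₀)           ≡⟨ solve 2 (λ t a → con 2 :* (t :* a) := t :* (a :+ a)) refl
                                                     (2 ^ suc D) (nonzeros G₀) ⟩
  2 ^ suc D * (nonzeros G₀ + nonzeros G₀) ≡⟨ cong (λ b → 2 ^ suc D * (nonzeros G₀ + b)) G₁≡G₀ ⟨
  2 ^ suc D * nonzeros G                  ∎
  where
  open ℕ.≤-Reasoning
  G₀ G₁ : CubeFn n
  G₀ = face₀ G
  G₁ = face₁ G
  G₁≡G₀ : nonzeros G₁ ≡ nonzeros G₀
  G₁≡G₀ = nonzeros-cong {F = G₁} {G = G₀} (λ x → x∙y⁻¹≈ε⇒x≈y _ _ (nonzeros≡0⇒≡0 ΔG≡0 x))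
  pos₀ : 0 < nonzeros G₀
  pos₀ = half-pos (subst (λ b → 0 < nonzeros G₀ + b) G₁≡G₀ pos)
    where
    half-pos : 0 < m + m → 0 < m
    half-pos {suc m} _ = s≤s z≤n
... | no ΔG≢0 = begin
  2 * (2 * 2 ^ n)                            ≤⟨ ℕ.*-monoʳ-≤ 2 (schwartz-zippel h₁ (ℕ.n≢0⇒n>0 ΔG≢0)) ⟩
  2 * (2 ^ D * nonzeros (Δ G))               ≤⟨ ℕ.*-monoʳ-≤ 2 (ℕ.*-monoʳ-≤ (2 ^ D) (nonzeros-sub G₁ G₀)) ⟩
  2 * (2 ^ D * (nonzeros G₁ + nonzeros G₀))  ≡⟨ solve 3 (λ t a b → con 2 :* (t :* (b :+ a))
                                                                := (con 2 :* t) :* (a :+ b))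
                                                        refl (2 ^ D) (nonzeros G₀) (nonzeros G₁) ⟩
  2 ^ suc D * nonzeros G                     ∎
  where
  open ℕ.≤-Reasoning
  G₀ G₁ : CubeFn n
  G₀ = face₀ G
  G₁ = face₁ G

-- Influences

-- nonzeros (∂ j F) is the number of points x with F x ≢ F (x with its j-th bit flipped).
totalInfluence : CubeFn n → ℕ
totalInfluence {n} F = ∑[ j < n ] nonzeros (∂ j F)

relevantCount : CubeFn n → ℕ
relevantCount {n} F = ∑[ j < n ] signum (nonzeros (∂ j F))

relevantCount-bound : {F : CubeFn n} → DegreeBelow (suc D) F →
  relevantCount F * (2 * 2 ^ n) ≤ 2 ^ D * totalInfluence F
relevantCount-bound {D = D} h = ∑-signum-*-≤ {c = 2 ^ D} (λ j → schwartz-zippel (DegreeBelow-∂ j h))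

totalInfluence-cover : ∀ {k} {F : CubeFn n} (g : Fin k → CubeFn n) →
  (∀ x y → ¬ F x ≡ F y → ∃[ i ] ¬ g i x ≡ g i y) → totalInfluence F ≤ ∑[ i < k ] totalInfluence (g i)
totalInfluence-cover {n} {k} {F} g separates = begin
  totalInfluence F
    ≤⟨ ∑-mono-≤ (λ j → nonzeros-cover (λ i → ∂ j (g i)) (cover j)) ⟩
  ∑[ j < n ] ∑[ i < k ] nonzeros (∂ j (g i))
    ≡⟨ ∑-comm (λ j i → nonzeros (∂ j (g i))) ⟩
  ∑[ i < k ] totalInfluence (g i) ∎
  where
  open ℕ.≤-Reasoning
  cover : ∀ j x → ¬ ∂ j F x ≡ 0ℚ → ∃[ i ] ¬ ∂ j (g i) x ≡ 0ℚ
  cover j x ∂F≢0 with separates _ _ (∂F≢0 ∘ x≈y⇒x∙y⁻¹≈ε)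
  ... | i , gi≢ = i , gi≢ ∘ x∙y⁻¹≈ε⇒x≈y _ _

‖‖²≡nonzeros : {G : CubeFn n} → (∀ x → G x ℚ.* G x ≡ fromℕ (nonzeroIndicator (G x))) →
  ‖ G ‖² ≡ fromℕ (nonzeros G)
‖‖²≡nonzeros {zero} square≡ = square≡ []
‖‖²≡nonzeros {suc n} {G} square≡ =
  trans (cong₂ ℚ._+_ (‖‖²≡nonzeros (square≡ ∘ (false ∷_))) (‖‖²≡nonzeros (square≡ ∘ (true ∷_))))
        (sym (fromℕ-+ (nonzeros (face₀ G)) (nonzeros (face₁ G))))

fromℕ-∑ : ∀ {k} (f : Fin k → ℕ) → fromℕ (∑[ i < k ] f i) ≡ ℚΣ.sum (λ i → fromℕ (f i))
fromℕ-∑ {zero} f = refl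
fromℕ-∑ {suc k} f = trans (fromℕ-+ (f zero) _) (cong (fromℕ (f zero) ℚ.+_) (fromℕ-∑ (f ∘ suc)))

module _ {g : CubeFn n} (g-boolean : Boolean g) where

  private
    difference² : ∀ x y → (g x ℚ.- g y) ℚ.* (g x ℚ.- g y) ≡ fromℕ (nonzeroIndicator (g x ℚ.- g y))
    difference² x y with g x | g y | g-boolean x | g-boolean y
    ... | _ | _ | inj₁ refl | inj₁ refl = refl
    ... | _ | _ | inj₁ refl | inj₂ refl = refl
    ... | _ | _ | inj₂ refl | inj₁ refl = refl
    ... | _ | _ | inj₂ refl | inj₂ refl = refl

    square : ∀ x → g x ℚ.* g x ≡ fromℕ (nonzeroIndicator (g x))
    square x with g x | g-boolean x
    ... | _ | inj₁ refl = refl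
    ... | _ | inj₂ refl = refl

  energy≡totalInfluence : energy g ≡ fromℕ (totalInfluence g)
  energy≡totalInfluence =
    trans (ℚΣ.sum-cong-≗ (λ j → ‖‖²≡nonzeros (λ x → difference² (x [ j ]≔ true) (x [ j ]≔ false))))
          (sym (fromℕ-∑ (λ j → nonzeros (∂ j g))))

  totalInfluence-boolean : DegreeBelow e g → totalInfluence g ≤ 4 * e * 2 ^ n
  totalInfluence-boolean {e} h = ℕ.≤-trans (fromℕ-cancel-≤ _ _ (begin
    fromℕ (totalInfluence g)                    ≡⟨ energy≡totalInfluence ⟨
    energy g                                    ≤⟨ energy-bound h ⟩
    fromℕ 4 ℚ.* fromℕ e ℚ.* ‖ g ‖²              ≡⟨ cong (fromℕ 4 ℚ.* fromℕ e ℚ.*_) (‖‖²≡nonzeros square) ⟩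
    fromℕ 4 ℚ.* fromℕ e ℚ.* fromℕ (nonzeros g)  ≡⟨ cong (ℚ._* fromℕ (nonzeros g)) (fromℕ-* 4 e) ⟨
    fromℕ (4 * e) ℚ.* fromℕ (nonzeros g)        ≡⟨ fromℕ-* (4 * e) (nonzeros g) ⟨
    fromℕ (4 * e * nonzeros g)                  ∎))
    (ℕ.*-monoʳ-≤ (4 * e) (nonzeros≤2^n g))
    where open ℚ.≤-Reasoning

-- Sparsity and relevant variables

length-filter-map : {A B : Set} {P : B → Set} (P? : Decidable P) (f : A → B) (xs : List A) →
  length (filter P? (map f xs)) ≡ length (filter (P? ∘ f) xs)
length-filter-map P? f [] = refl
length-filter-map P? f (x ∷ xs) with does (P? (f x))
... | true = cong suc (length-filter-map P? f xs)
... | false = length-filter-map P? f xs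

sparsity≡nonzeros : (q : MultilinearPoly n) → sparsity q ≡ nonzeros q
sparsity≡nonzeros {zero} q with q [] ℚ.≟ 0ℚ
... | yes _ = refl
... | no _ = refl
sparsity≡nonzeros {suc n} q = begin
  length (filter q≢0? (map (false ∷_) cube ++ map (true ∷_) cube))
    ≡⟨ cong length (filter-++ q≢0? (map (false ∷_) cube) (map (true ∷_) cube)) ⟩
  length (filter q≢0? (map (false ∷_) cube) ++ filter q≢0? (map (true ∷_) cube))
    ≡⟨ length-++ (filter q≢0? (map (false ∷_) cube)) ⟩
  length (filter q≢0? (map (false ∷_) cube)) + length (filter q≢0? (map (true ∷_) cube))
    ≡⟨ cong₂ _+_ (length-filter-map q≢0? (false ∷_) cube) (length-filter-map q≢0? (true ∷_) cube) ⟩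
  sparsity (face₀ q) + sparsity (face₁ q)
    ≡⟨ cong₂ _+_ (sparsity≡nonzeros (face₀ q)) (sparsity≡nonzeros (face₁ q)) ⟩
  nonzeros q ∎
  where
  open ≡-Reasoning
  cube : List (Vec Bool n)
  cube = allBoolVecs n
  q≢0? : Decidable (λ S → ¬ q S ≡ 0ℚ)
  q≢0? S = ¬? (q S ℚ.≟ 0ℚ)

relevantCount-cong : {F G : CubeFn n} → F ≗ G → relevantCount F ≡ relevantCount G
relevantCount-cong F≗G = sum-cong-≗ (λ j → cong signum (nonzeros-cong (∂-cong j F≗G)))

relevantCount⁺ : CubeFn (suc n) → ℕ
relevantCount⁺ {n} F = ∑[ j < n ] signum (nonzeros (∂ (suc j) F))

relevantCount-suc : (F : CubeFn (suc n)) → ¬ nonzeros (Δ F) ≡ 0 → relevantCount F ≡ suc (relevantCount⁺ F)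
relevantCount-suc F ΔF≢0 = cong (_+ relevantCount⁺ F) (signum-double ΔF≢0)
  where
  signum-double : ¬ m ≡ 0 → signum (m + m) ≡ 1
  signum-double {zero} m≢0 = contradiction refl m≢0
  signum-double {suc m} _ = refl

relevantCount-face₀ : (F : CubeFn (suc n)) → relevantCount (face₀ F) ≤ relevantCount⁺ F
relevantCount-face₀ F =
  ∑-signum-mono {f = λ j → nonzeros (∂ j (face₀ F))} {g = λ j → nonzeros (∂ (suc j) F)}
                (λ j pos → ℕ.<-≤-trans pos (ℕ.m≤m+n _ _))

relevantCount-Δ : (F : CubeFn (suc n)) → relevantCount (Δ F) ≤ relevantCount⁺ F
relevantCount-Δ F =
  ∑-signum-mono {f = λ j → nonzeros (∂ j (Δ F))} {g = λ j → nonzeros (∂ (suc j) F)}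
                (λ j pos → ℕ.<-≤-trans pos (∂Δ≤ j))
  where
  open ℕ.≤-Reasoning
  ∂Δ≤ : ∀ j → nonzeros (∂ j (Δ F)) ≤ nonzeros (∂ (suc j) F)
  ∂Δ≤ j = begin
    nonzeros (∂ j (Δ F))                                ≡⟨ nonzeros-cong (∂-Δ j F) ⟩
    nonzeros (Δ (∂ (suc j) F))                          ≤⟨ nonzeros-sub (∂ j (face₁ F)) (∂ j (face₀ F)) ⟩
    nonzeros (∂ j (face₁ F)) + nonzeros (∂ j (face₀ F)) ≡⟨ ℕ.+-comm (nonzeros (∂ j (face₁ F))) _ ⟩
    nonzeros (∂ (suc j) F)                              ∎

module _ (q : MultilinearPoly (suc n)) where

  relevantCount-eval-face₀ : relevantCount (eval (face₀ q)) ≤ relevantCount⁺ (eval q)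
  relevantCount-eval-face₀ =
    ℕ.≤-trans (ℕ.≤-reflexive (relevantCount-cong (sym ∘ face₀-eval q))) (relevantCount-face₀ (eval q))

  relevantCount-eval-face₁ : relevantCount (eval (face₁ q)) ≤ relevantCount⁺ (eval q)
  relevantCount-eval-face₁ =
    ℕ.≤-trans (ℕ.≤-reflexive (relevantCount-cong (sym ∘ Δ-eval q))) (relevantCount-Δ (eval q))

  face₁≡0⇒nonzeros≤ : ∀ d → (∀ S → face₁ q S ≡ 0ℚ) →
    nonzeros (face₀ q) ≤ suc (relevantCount (eval (face₀ q))) ^ d →
    nonzeros q ≤ suc (relevantCount (eval q)) ^ d
  face₁≡0⇒nonzeros≤ d q₁≡0 bound₀ = begin
    nonzeros (face₀ q) + nonzeros (face₁ q)   ≡⟨ cong (nonzeros (face₀ q) +_) (≡0⇒nonzeros≡0 q₁≡0) ⟩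
    nonzeros (face₀ q) + 0                    ≡⟨ ℕ.+-identityʳ _ ⟩
    nonzeros (face₀ q)                        ≤⟨ bound₀ ⟩
    suc (relevantCount (eval (face₀ q))) ^ d  ≤⟨ ℕ.^-monoˡ-≤ d (s≤s r₀≤r) ⟩
    suc (relevantCount (eval q)) ^ d          ∎
    where
    open ℕ.≤-Reasoning
    r₀≤r : relevantCount (eval (face₀ q)) ≤ relevantCount (eval q)
    r₀≤r = ℕ.≤-trans relevantCount-eval-face₀ (ℕ.m≤n+m _ _)

[1+r]^[1+d]+[1+r]^d≤[2+r]^[1+d] : ∀ r d → suc r ^ suc d + suc r ^ d ≤ suc (suc r) ^ suc d
[1+r]^[1+d]+[1+r]^d≤[2+r]^[1+d] r d = begin
  suc r * suc r ^ d + suc r ^ d ≡⟨ ℕ.+-comm (suc r * suc r ^ d) (suc r ^ d) ⟩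
  suc (suc r) * suc r ^ d        ≤⟨ ℕ.*-monoʳ-≤ (suc (suc r)) (ℕ.^-monoˡ-≤ d (ℕ.n≤1+n (suc r))) ⟩
  suc (suc r) ^ suc d            ∎
  where open ℕ.≤-Reasoning

nonzeros≤relevantCount^d : (d : ℕ) (q : MultilinearPoly n) → DegreeAtMost d q →
  nonzeros q ≤ suc (relevantCount (eval q)) ^ d
nonzeros≤relevantCount^d {zero} d q _ = ℕ.≤-trans (nonzeroIndicator≤1 (q [])) (ℕ.m^n>0 1 d)
nonzeros≤relevantCount^d {suc n} zero q deg =
  face₁≡0⇒nonzeros≤ q zero q₁≡0 (nonzeros≤relevantCount^d zero (face₀ q) (deg ∘ (false ∷_)))
  where
  q₁≡0 : ∀ S → face₁ q S ≡ 0ℚ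
  q₁≡0 S with face₁ q S ℚ.≟ 0ℚ
  ... | yes q₁S≡0 = q₁S≡0
  ... | no q₁S≢0 = contradiction (deg (true ∷ S) q₁S≢0) (λ ())
nonzeros≤relevantCount^d {suc n} (suc d) q deg with nonzeros (Δ (eval q)) ℕ.≟ 0
... | yes ΔF≡0 =
  face₁≡0⇒nonzeros≤ q (suc d)
    (eval≡0⇒coeffs≡0 (face₁ q) (λ x → trans (sym (Δ-eval q x)) (nonzeros≡0⇒≡0 ΔF≡0 x)))
    (nonzeros≤relevantCount^d (suc d) (face₀ q) (deg ∘ (false ∷_)))
... | no ΔF≢0 = begin
  nonzeros (face₀ q) + nonzeros (face₁ q)
    ≤⟨ ℕ.+-mono-≤ (nonzeros≤relevantCount^d (suc d) (face₀ q) (deg ∘ (false ∷_)))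
                  (nonzeros≤relevantCount^d d (face₁ q) deg₁) ⟩
  suc (relevantCount (eval (face₀ q))) ^ suc d + suc (relevantCount (eval (face₁ q))) ^ d
    ≤⟨ ℕ.+-mono-≤ (ℕ.^-monoˡ-≤ (suc d) (s≤s (relevantCount-eval-face₀ q)))
                  (ℕ.^-monoˡ-≤ d (s≤s (relevantCount-eval-face₁ q))) ⟩
  suc (relevantCount⁺ (eval q)) ^ suc d + suc (relevantCount⁺ (eval q)) ^ d
    ≤⟨ [1+r]^[1+d]+[1+r]^d≤[2+r]^[1+d] (relevantCount⁺ (eval q)) d ⟩
  suc (suc (relevantCount⁺ (eval q))) ^ suc d
    ≡⟨ cong (λ r → suc r ^ suc d) (relevantCount-suc (eval q) ΔF≢0) ⟨
  suc (relevantCount (eval q)) ^ suc d ∎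
  where
  open ℕ.≤-Reasoning
  deg₁ : DegreeAtMost d (face₁ q)
  deg₁ S q₁S≢0 = ℕ.≤-pred (deg (true ∷ S) q₁S≢0)

relevantCount-eval≤ : (d : ℕ) (q : MultilinearPoly n) → DegreeAtMost d q →
  relevantCount (eval q) ≤ 2 ^ suc d * numDistinctValues q * suc (numDistinctValues q * d)
relevantCount-eval≤ {n} d q deg = ℕ.*-cancelʳ-≤ _ _ (2 * 2 ^ n) {{ℕ.m^n≢0 2 (suc n)}} (begin
  relevantCount F * (2 * 2 ^ n)               ≤⟨ relevantCount-bound hF ⟩
  2 ^ d * totalInfluence F                    ≤⟨ ℕ.*-monoʳ-≤ (2 ^ d) (totalInfluence-cover g separates) ⟩
  2 ^ d * ∑[ i < k ] totalInfluence (g i)     ≤⟨ ℕ.*-monoʳ-≤ (2 ^ d) (∑-≤-* (λ i →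
                                                   totalInfluence-boolean (g-boolean i) (g-degree i))) ⟩
  2 ^ d * (k * (4 * suc (k * d) * 2 ^ n))     ≡⟨ solve 4 (λ t k d p → t :* (k :* (con 4 :* (con 1 :+ k :* d) :* p))
                                                                  := (con 2 :* t) :* k :* (con 1 :+ k :* d) :* (con 2 :* p))
                                                          refl (2 ^ d) k d (2 ^ n) ⟩
  2 ^ suc d * k * suc (k * d) * (2 * 2 ^ n)   ∎)
  where
  open ℕ.≤-Reasoning
  F : CubeFn n
  F = eval q
  L : List ℚ
  L = deduplicate ℚ._≟_ (map F (allBoolVecs n))
  k : ℕ
  k = length L
  F∈L : ∀ x → F x ∈ L
  F∈L x = ∈-deduplicate⁺ ℚ._≟_ (∈-map⁺ F (∈-allBoolVecs x))
  hF : DegreeBelow (suc d) F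
  hF = DegreeBelow-eval q (λ S q≢0 → s≤s (deg S q≢0))
  g : Fin k → CubeFn n
  g i x = lagrange L (lookup L i) (F x)
  g-boolean : ∀ i → Boolean (g i)
  g-boolean i = lagrange-boolean F∈L (lookup L i)
  g-degree : ∀ i → DegreeBelow (suc (k * d)) (g i)
  g-degree i = DegreeBelow-lagrange L (lookup L i) hF
  separates : ∀ x y → ¬ F x ≡ F y → ∃[ i ] ¬ g i x ≡ g i y
  separates x y Fx≢Fy = index (F∈L x) , lagrange-separates F∈L x y (lookup-index (F∈L x)) Fx≢Fy

1+2^m≤2^[1+m] : ∀ m → suc (2 ^ m) ≤ 2 ^ suc m
1+2^m≤2^[1+m] m = ℕ.+-mono-≤ (ℕ.m^n>0 2 m) (ℕ.≤-reflexive (sym (ℕ.+-identityʳ (2 ^ m))))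

n<2^n : ∀ m → m < 2 ^ m
n<2^n zero = s≤s z≤n
n<2^n (suc m) = ℕ.≤-trans (s≤s (n<2^n m)) (1+2^m≤2^[1+m] m)

2^[1+d]*k*[1+k*d]<2^[2*d*[k+2]] : ∀ d k → 1 ≤ d → 2 ^ suc d * k * suc (k * d) < 2 ^ (2 * d * (k + 2))
2^[1+d]*k*[1+k*d]<2^[2*d*[k+2]] d@(suc d′) k _ = begin
  suc (2 ^ suc d * k * suc (k * d))
    ≤⟨ s≤s (ℕ.*-mono-≤ (ℕ.*-monoʳ-≤ (2 ^ suc d) (ℕ.<⇒≤ (n<2^n k))) 1+kd≤2^k*2^d) ⟩
  suc (2 ^ suc d * 2 ^ k * (2 ^ k * 2 ^ d))
    ≡⟨ cong suc 2^E≡ ⟨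
  suc (2 ^ E)
    ≤⟨ 1+2^m≤2^[1+m] E ⟩
  2 ^ suc E
    ≤⟨ ℕ.^-monoʳ-≤ 2 (ℕ.≤-trans (ℕ.m≤m+n (suc E) _) (ℕ.≤-reflexive E-identity)) ⟩
  2 ^ (2 * d * (k + 2)) ∎
  where
  open ℕ.≤-Reasoning
  E : ℕ
  E = suc d + (k + (k + d))
  E-identity : suc E + (2 * d′ * k + 2 * d′) ≡ 2 * d * (k + 2)
  E-identity = solve 2 (λ d′ k → con 1 :+ ((con 2 :+ d′) :+ (k :+ (k :+ (con 1 :+ d′))))
                                   :+ (con 2 :* d′ :* k :+ con 2 :* d′)
                                 := con 2 :* (con 1 :+ d′) :* (k :+ con 2)) refl d′ k
  1+kd≤2^k*2^d : suc (k * d) ≤ 2 ^ k * 2 ^ d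
  1+kd≤2^k*2^d =
    ℕ.≤-trans (s≤s (ℕ.≤-trans (ℕ.*-monoʳ-≤ k (ℕ.n≤1+n d)) (ℕ.m≤n+m _ d)))
              (ℕ.*-mono-≤ (n<2^n k) (n<2^n d))
  2^E≡ : 2 ^ E ≡ 2 ^ suc d * 2 ^ k * (2 ^ k * 2 ^ d)
  2^E≡ = begin-equality
    2 ^ (suc d + (k + (k + d)))           ≡⟨ ℕ.^-distribˡ-+-* 2 (suc d) (k + (k + d)) ⟩
    2 ^ suc d * 2 ^ (k + (k + d))         ≡⟨ cong (2 ^ suc d *_) (ℕ.^-distribˡ-+-* 2 k (k + d)) ⟩
    2 ^ suc d * (2 ^ k * 2 ^ (k + d))     ≡⟨ ℕ.*-assoc (2 ^ suc d) (2 ^ k) (2 ^ (k + d)) ⟨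
    2 ^ suc d * 2 ^ k * 2 ^ (k + d)       ≡⟨ cong (2 ^ suc d * 2 ^ k *_) (ℕ.^-distribˡ-+-* 2 k d) ⟩
    2 ^ suc d * 2 ^ k * (2 ^ k * 2 ^ d)   ∎

lemma6p3 : (n d : ℕ) → 1 ≤ d → (q : MultilinearPoly n) → DegreeAtMost d q →
    sparsity q ≤ 2 ^ (2 * (d * d) * (numDistinctValues q + 2))
lemma6p3 n d 1≤d q deg = begin
  sparsity q                        ≡⟨ sparsity≡nonzeros q ⟩
  nonzeros q                        ≤⟨ nonzeros≤relevantCount^d d q deg ⟩
  suc (relevantCount (eval q)) ^ d  ≤⟨ ℕ.^-monoˡ-≤ d 1+r≤ ⟩
  (2 ^ (2 * d * (k + 2))) ^ d       ≡⟨ ℕ.^-*-assoc 2 (2 * d * (k + 2)) d ⟩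
  2 ^ (2 * d * (k + 2) * d)         ≡⟨ cong (2 ^_) (solve 2 (λ d k → con 2 :* d :* (k :+ con 2) :* d
                                                              := con 2 :* (d :* d) :* (k :+ con 2)) refl d k) ⟩
  2 ^ (2 * (d * d) * (k + 2))       ∎
  where
  open ℕ.≤-Reasoning
  k : ℕ
  k = numDistinctValues q
  1+r≤ : suc (relevantCount (eval q)) ≤ 2 ^ (2 * d * (k + 2))
  1+r≤ = ℕ.≤-trans (s≤s (relevantCount-eval≤ d q deg)) (2^[1+d]*k*[1+k*d]<2^[2*d*[k+2]] d k 1≤d)
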